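{- Let $\Sigma$ be a signed graph and $A$ a negation set of $\Sigma$. Then $A$ is bipartite (i.e., the graph formed by the edges of $A$ and their endpoints is bipartite) if and only if there exists a negation set $B$ of $\Sigma$ with $A\cap B=\emptyset$.
   Context: Throughout, graphs are finite, simple and connected. A signed graph is a pair $\Sigma=(\Gamma,\sigma)$ with $\sigma: E(\Gamma)\to\{+,-\}$. The sign of a circle (cycle) is the product of the signs of its edges; $\Sigma$ is balanced if every circle is positive. A negation set is a set of edges whose negation (changing the sign of each of its edges) yields a balanced signed graph. -}

module Defs where

open import Data.Nat using (ℕ; zero; suc; _≤_)
open import Data.Fin using (Fin; inject₁; fromℕ) renaming (zero to fzero; suc to fsuc)
open import Data.Fin.Subset using (Subset; _∈_; _∉_)
open import Data.Fin.Subset.Properties using (_∈?_)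
open import Data.Bool using (Bool; true; false; if_then_else_)
open import Data.Product using (Σ; _×_; _,_; proj₁; proj₂; ∃-syntax)
open import Data.Sum using (_⊎_)
open import Relation.Binary.PropositionalEquality using (_≡_; _≢_)
open import Relation.Nullary using (yes; no)
open import Function.Definitions using (Injective)

data Sign : Set where
  plus minus : Sign

negate : Sign → Sign
negate plus  = minus
negate minus = plus

_·_ : Sign → Sign → Sign
plus  · s = s
minus · s = negate s

prod : ∀ k → (Fin k → Sign) → Sign
prod zero    f = plus
prod (suc k) f = f fzero · prod k (λ i → f (fsuc i))

module _ {n m : ℕ} (ends : Fin m → Fin n × Fin n) where

  Joins : Fin m → Fin n → Fin n → Set
  Joins e u v = ends e ≡ (u , v) ⊎ ends e ≡ (v , u)

  data Walk : Fin n → Fin n → Set where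
    [] : ∀ {u} → Walk u u
    step : ∀ {u w v} (e : Fin m) → Joins e u w → Walk w v → Walk u v

record Graph : Set where
  field
    n m      : ℕ
    ends     : Fin m → Fin n × Fin n
    noLoops  : ∀ e → proj₁ (ends e) ≢ proj₂ (ends e)
    noMulti  : ∀ e f → Joins ends f (proj₁ (ends e)) (proj₂ (ends e)) → e ≡ f
    connected : ∀ u v → Walk ends u v

open Graph public

record SignedGraph : Set where
  field
    graph : Graph
    σ     : Fin (m graph) → Sign

open SignedGraph public

record Circle (G : Graph) : Set where
  field
    len    : ℕ
    len≥3  : 3 ≤ len
    vtx    : Fin (suc len) → Fin (n G)
    closed : vtx (fromℕ len) ≡ vtx fzero
    distinct : Injective _≡_ _≡_ (λ (i : Fin len) → vtx (inject₁ i))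
    edge   : Fin len → Fin (m G)
    joins  : ∀ i → Joins (ends G) (edge i) (vtx (inject₁ i)) (vtx (fsuc i))

open Circle public

circleSign : (S : SignedGraph) → Circle (graph S) → Sign
circleSign S C = prod (len C) (λ i → σ S (edge C i))

Balanced : SignedGraph → Set
Balanced S = ∀ (C : Circle (graph S)) → circleSign S C ≡ plus

negateSet : (S : SignedGraph) → Subset (m (graph S)) → SignedGraph
negateSet S A = record
  { graph = graph S
  ; σ = λ e → if does (e ∈? A) then negate (σ S e) else σ S e }
  where open import Relation.Nullary using (does)

NegationSet : (S : SignedGraph) → Subset (m (graph S)) → Set
NegationSet S A = Balanced (negateSet S A)

-- The subgraph formed by the edges of A and their endpoints is bipartite:
-- a 2-colouring of the vertices in which every edge of A has differently
-- coloured endpoints (vertices not incident to A are unconstrained).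
BipartiteEdgeSet : (G : Graph) → Subset (m G) → Set
BipartiteEdgeSet G A =
  Σ (Fin (n G) → Bool) λ c → ∀ e → e ∈ A → c (proj₁ (ends G e)) ≢ c (proj₂ (ends G e))

Disjoint : ∀ {k} → Subset k → Subset k → Set
Disjoint A B = ∀ e → e ∈ A → e ∉ B

-- Negating A and then B multiplies each edge sign by the sign of A ⊕ B, so A and B are both
-- negation sets exactly when A ⊕ B is positive on every circle, i.e. (the graph being
-- connected) when A ⊕ B is the cut of a 2-colouring. If A is properly 2-coloured by c, the
-- set B = A ⊕ δ(c) is such a negation set and is disjoint from A. Conversely, if B is
-- disjoint from A then A ⊆ A ⊕ B, which is a cut, so A is bipartite.
module Submission where

open import Defs
open import Data.Fin.Subset using (Subset)
open import Data.Product using (Σ; _×_)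

open import Algebra.Bundles using (CommutativeSemigroup)
open import Algebra.Structures using (IsCommutativeSemigroup)
import Algebra.Properties.CommutativeSemigroup as CommutativeSemigroupProperties
open import Data.Bool using (Bool; true; false; _xor_)
open import Data.Empty using (⊥; ⊥-elim)
open import Data.Fin using (Fin; inject₁; fromℕ; _≟_) renaming (zero to fzero; suc to fsuc)
open import Data.Fin.Properties using (fromℕ≢inject₁; inject₁-injective)
open import Data.Fin.Subset using (_∈_)
open import Data.Fin.Subset.Properties using (_∈?_)
open import Data.Nat using (ℕ; zero; suc; _≤_; z≤n; s≤s)
open import Data.Product using (_,_; proj₁; proj₂)
open import Data.Sum using (_⊎_; inj₁; inj₂)
open import Data.Unit using (⊤; tt)
open import Data.Vec using (lookup; tabulate)
open import Data.Vec.Properties using (lookup∘tabulate; []=⇒lookup; lookup⇒[]=)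
open import Function.Definitions using (Injective)
open import Relation.Binary.PropositionalEquality
open import Relation.Nullary using (¬_; Dec; yes; no)

·-identityʳ : ∀ s → s · plus ≡ s
·-identityʳ plus  = refl
·-identityʳ minus = refl

·-comm : ∀ a b → a · b ≡ b · a
·-comm plus  plus  = refl
·-comm plus  minus = refl
·-comm minus plus  = refl
·-comm minus minus = refl

·-assoc : ∀ a b c → (a · b) · c ≡ a · (b · c)
·-assoc plus  b     c     = refl
·-assoc minus plus  c     = refl
·-assoc minus minus plus  = refl
·-assoc minus minus minus = refl

·-inverse : ∀ s → s · s ≡ plus
·-inverse plus  = refl
·-inverse minus = refl

·-cancelˡ : ∀ a b → a · (a · b) ≡ b
·-cancelˡ plus  b     = refl
·-cancelˡ minus plus  = refl
·-cancelˡ minus minus = refl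

·≡plus⇒≡ : ∀ {a b} → a · b ≡ plus → a ≡ b
·≡plus⇒≡ {plus}  {plus}  _ = refl
·≡plus⇒≡ {minus} {minus} _ = refl

negate-≢ : ∀ s → negate s ≢ s
negate-≢ plus  ()
negate-≢ minus ()

·-isCommutativeSemigroup : IsCommutativeSemigroup _≡_ _·_
·-isCommutativeSemigroup = record
  { isSemigroup = record
    { isMagma = record { isEquivalence = isEquivalence ; ∙-cong = cong₂ _·_ }
    ; assoc   = ·-assoc
    }
  ; comm = ·-comm
  }

·-commutativeSemigroup : CommutativeSemigroup _ _
·-commutativeSemigroup = record { isCommutativeSemigroup = ·-isCommutativeSemigroup }

open CommutativeSemigroupProperties ·-commutativeSemigroup using (interchange)

prod-cong : ∀ k {f g : Fin k → Sign} → (∀ i → f i ≡ g i) → prod k f ≡ prod k g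
prod-cong zero    f≗g = refl
prod-cong (suc k) f≗g = cong₂ _·_ (f≗g fzero) (prod-cong k (λ i → f≗g (fsuc i)))

prod-· : ∀ k (f g : Fin k → Sign) → prod k f · prod k g ≡ prod k (λ i → f i · g i)
prod-· zero    f g = refl
prod-· (suc k) f g = begin
  (f fzero · prod k (f ∘fsuc)) · (g fzero · prod k (g ∘fsuc))
    ≡⟨ interchange (f fzero) (prod k (f ∘fsuc)) (g fzero) (prod k (g ∘fsuc)) ⟩
  (f fzero · g fzero) · (prod k (f ∘fsuc) · prod k (g ∘fsuc))
    ≡⟨ cong ((f fzero · g fzero) ·_) (prod-· k (f ∘fsuc) (g ∘fsuc)) ⟩
  (f fzero · g fzero) · prod k (λ i → f (fsuc i) · g (fsuc i))   ∎
  where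
    open ≡-Reasoning
    _∘fsuc : (Fin (suc k) → Sign) → Fin k → Sign
    (h ∘fsuc) i = h (fsuc i)

prod-telescope : ∀ k (h : Fin (suc k) → Sign) →
  prod k (λ i → h (inject₁ i) · h (fsuc i)) ≡ h fzero · h (fromℕ k)
prod-telescope zero    h = sym (·-inverse (h fzero))
prod-telescope (suc k) h = begin
  (h fzero · h (fsuc fzero)) · prod k (λ i → h (inject₁ (fsuc i)) · h (fsuc (fsuc i)))
    ≡⟨ cong ((h fzero · h (fsuc fzero)) ·_) (prod-telescope k (λ i → h (fsuc i))) ⟩
  (h fzero · h (fsuc fzero)) · (h (fsuc fzero) · h (fromℕ (suc k)))
    ≡⟨ ·-assoc (h fzero) (h (fsuc fzero)) _ ⟩
  h fzero · (h (fsuc fzero) · (h (fsuc fzero) · h (fromℕ (suc k))))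
    ≡⟨ cong (h fzero ·_) (·-cancelˡ (h (fsuc fzero)) _) ⟩
  h fzero · h (fromℕ (suc k))   ∎
  where open ≡-Reasoning

sign : Bool → Sign
sign true  = minus
sign false = plus

sign-xor : ∀ a b → sign (a xor b) ≡ sign a · sign b
sign-xor true  true  = refl
sign-xor true  false = refl
sign-xor false b     = refl

negationSign : ∀ {k} → Subset k → Fin k → Sign
negationSign A e = sign (lookup A e)

negateSet-σ : ∀ S A e → σ (negateSet S A) e ≡ negationSign A e · σ S e
negateSet-σ S A e with e ∈? A
... | yes e∈A rewrite []=⇒lookup e∈A = refl
... | no  e∉A with lookup A e in eq
...   | true  = ⊥-elim (e∉A (lookup⇒[]= e A eq))
...   | false = refl

differenceSign : ∀ {k} → Subset k → Subset k → Fin k → Sign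
differenceSign A B e = negationSign A e · negationSign B e

circleSign-negateSet-· : ∀ S A B (C : Circle (graph S)) →
  circleSign (negateSet S A) C · circleSign (negateSet S B) C
    ≡ prod (len C) (λ i → differenceSign A B (edge C i))
circleSign-negateSet-· S A B C =
  trans (prod-· (len C) _ _) (prod-cong (len C) (λ i → pointwise (edge C i)))
  where
    open ≡-Reasoning
    pointwise : ∀ e → σ (negateSet S A) e · σ (negateSet S B) e ≡ differenceSign A B e
    pointwise e = begin
      σ (negateSet S A) e · σ (negateSet S B) e
        ≡⟨ cong₂ _·_ (negateSet-σ S A e) (negateSet-σ S B e) ⟩
      (negationSign A e · σ S e) · (negationSign B e · σ S e)
        ≡⟨ interchange (negationSign A e) (σ S e) (negationSign B e) (σ S e) ⟩
      differenceSign A B e · (σ S e · σ S e)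
        ≡⟨ cong (differenceSign A B e ·_) (·-inverse (σ S e)) ⟩
      differenceSign A B e · plus
        ≡⟨ ·-identityʳ _ ⟩
      differenceSign A B e   ∎

AllCirclesPositive : (G : Graph) → (Fin (m G) → Sign) → Set
AllCirclesPositive G w = ∀ (C : Circle G) → prod (len C) (λ i → w (edge C i)) ≡ plus

negationSets⇒differencePositive : ∀ S A B → NegationSet S A → NegationSet S B →
  AllCirclesPositive (graph S) (differenceSign A B)
negationSets⇒differencePositive S A B negA negB C =
  trans (sym (circleSign-negateSet-· S A B C)) (cong₂ _·_ (negA C) (negB C))

module _ (G : Graph) where

  switchingSign : (Fin (n G) → Sign) → Fin (m G) → Sign
  switchingSign h e = h (proj₁ (ends G e)) · h (proj₂ (ends G e))

  switchingSign-joins : ∀ h {e u v} → Joins (ends G) e u v → switchingSign h e ≡ h u · h v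
  switchingSign-joins h (inj₁ refl) = refl
  switchingSign-joins h {u = u} {v} (inj₂ refl) = ·-comm (h v) (h u)

  switching-allCirclesPositive : ∀ h → AllCirclesPositive G (switchingSign h)
  switching-allCirclesPositive h C = begin
    prod (len C) (λ i → switchingSign h (edge C i))
      ≡⟨ prod-cong (len C) (λ i → switchingSign-joins h (joins C i)) ⟩
    prod (len C) (λ i → h (vtx C (inject₁ i)) · h (vtx C (fsuc i)))
      ≡⟨ prod-telescope (len C) (λ i → h (vtx C i)) ⟩
    h (vtx C fzero) · h (vtx C (fromℕ (len C)))
      ≡⟨ cong (λ v → h (vtx C fzero) · h v) (closed C) ⟩
    h (vtx C fzero) · h (vtx C fzero)
      ≡⟨ ·-inverse (h (vtx C fzero)) ⟩
    plus   ∎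
    where open ≡-Reasoning

module WalkSigns (G : Graph) (w : Fin (m G) → Sign) where

  V : Set
  V = Fin (n G)

  W : V → V → Set
  W = Walk (ends G)

  Joins′ : Fin (m G) → V → V → Set
  Joins′ = Joins (ends G)

  weight : ∀ {u v} → W u v → Sign
  weight []           = plus
  weight (step e _ P) = w e · weight P

  _++_ : ∀ {a b c} → W a b → W b c → W a c
  []           ++ Q = Q
  step e j P   ++ Q = step e j (P ++ Q)

  weight-++ : ∀ {a b c} (P : W a b) (Q : W b c) → weight (P ++ Q) ≡ weight P · weight Q
  weight-++ []           Q = refl
  weight-++ (step e j P) Q = trans (cong (w e ·_) (weight-++ P Q)) (sym (·-assoc (w e) _ _))

  joins-sym : ∀ {e a b} → Joins′ e a b → Joins′ e b a
  joins-sym (inj₁ eq) = inj₂ eq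
  joins-sym (inj₂ eq) = inj₁ eq

  reverse : ∀ {a b} → W a b → W b a
  reverse []           = []
  reverse (step e j P) = reverse P ++ step e (joins-sym j) []

  weight-reverse : ∀ {a b} (P : W a b) → weight (reverse P) ≡ weight P
  weight-reverse []           = refl
  weight-reverse (step e j P) = begin
    weight (reverse P ++ step e (joins-sym j) [])   ≡⟨ weight-++ (reverse P) _ ⟩
    weight (reverse P) · (w e · plus)                ≡⟨ cong₂ _·_ (weight-reverse P) (·-identityʳ (w e)) ⟩
    weight P · w e                                   ≡⟨ ·-comm (weight P) (w e) ⟩
    w e · weight P                                   ∎
    where open ≡-Reasoning

  _∈W_ : ∀ {u v} → V → W u v → Set
  _∈W_ {u} x []           = x ≡ u
  _∈W_ {u} x (step _ _ P) = x ≡ u ⊎ x ∈W P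

  _∈W?_ : ∀ {u v} (x : V) (P : W u v) → Dec (x ∈W P)
  _∈W?_ {u} x []           = x ≟ u
  _∈W?_ {u} x (step e j P) with x ≟ u | x ∈W? P
  ... | yes x≡u | _       = yes (inj₁ x≡u)
  ... | no  _   | yes x∈P = yes (inj₂ x∈P)
  ... | no  x≢u | no  x∉P = no λ { (inj₁ x≡u) → x≢u x≡u ; (inj₂ x∈P) → x∉P x∈P }

  end∈W : ∀ {u v} (P : W u v) → v ∈W P
  end∈W []           = refl
  end∈W (step _ _ P) = inj₂ (end∈W P)

  IsPath : ∀ {u v} → W u v → Set
  IsPath []               = ⊤
  IsPath {u} (step _ _ P) = ¬ (u ∈W P) × IsPath P

  record Split {u v} (x : V) (P : W u v) : Set where
    field
      prefix        : W u x
      suffix        : W x v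
      prefix-isPath : IsPath prefix
      suffix-isPath : IsPath suffix
      prefix-⊆      : ∀ {y} → y ∈W prefix → y ∈W P
      weight-split  : weight P ≡ weight prefix · weight suffix

  split : ∀ {u v} x (P : W u v) → x ∈W P → IsPath P → Split x P
  split x [] refl tt = record
    { prefix = [] ; suffix = [] ; prefix-isPath = tt ; suffix-isPath = tt
    ; prefix-⊆ = λ y∈ → y∈ ; weight-split = refl }
  split x (step e j P) (inj₁ refl) isPath = record
    { prefix = [] ; suffix = step e j P ; prefix-isPath = tt ; suffix-isPath = isPath
    ; prefix-⊆ = inj₁ ; weight-split = refl }
  split {u} x (step e j P) (inj₂ x∈P) (u∉P , isPath) = record
    { prefix        = step e j prefix
    ; suffix        = suffix
    ; prefix-isPath = (λ u∈prefix → u∉P (prefix-⊆ u∈prefix)) , prefix-isPath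
    ; suffix-isPath = suffix-isPath
    ; prefix-⊆      = λ { (inj₁ y≡u) → inj₁ y≡u ; (inj₂ y∈) → inj₂ (prefix-⊆ y∈) }
    ; weight-split  = trans (cong (w e ·_) weight-split) (sym (·-assoc (w e) _ _))
    }
    where open Split (split x P x∈P isPath)

  length : ∀ {u v} → W u v → ℕ
  length []           = 0
  length (step _ _ P) = suc (length P)

  vertexAt : ∀ {u v} (P : W u v) → Fin (suc (length P)) → V
  vertexAt {u} P            fzero    = u
  vertexAt     (step _ _ P) (fsuc i) = vertexAt P i

  edgeAt : ∀ {u v} (P : W u v) → Fin (length P) → Fin (m G)
  edgeAt (step e _ P) fzero    = e
  edgeAt (step _ _ P) (fsuc i) = edgeAt P i

  edgeAt-joins : ∀ {u v} (P : W u v) i →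
    Joins′ (edgeAt P i) (vertexAt P (inject₁ i)) (vertexAt P (fsuc i))
  edgeAt-joins (step _ j P) fzero    = j
  edgeAt-joins (step _ _ P) (fsuc i) = edgeAt-joins P i

  vertexAt-last : ∀ {u v} (P : W u v) → vertexAt P (fromℕ (length P)) ≡ v
  vertexAt-last []           = refl
  vertexAt-last (step _ _ P) = vertexAt-last P

  vertexAt-∈W : ∀ {u v} (P : W u v) i → vertexAt P i ∈W P
  vertexAt-∈W []           fzero    = refl
  vertexAt-∈W (step _ _ P) fzero    = inj₁ refl
  vertexAt-∈W (step _ _ P) (fsuc i) = inj₂ (vertexAt-∈W P i)

  vertexAt-injective : ∀ {u v} (P : W u v) → IsPath P → Injective _≡_ _≡_ (vertexAt P)
  vertexAt-injective []           _          {fzero}  {fzero}  _  = refl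
  vertexAt-injective (step _ _ P) _          {fzero}  {fzero}  _  = refl
  vertexAt-injective (step _ _ P) (u∉P , _)  {fzero}  {fsuc k} eq =
    ⊥-elim (u∉P (subst (_∈W P) (sym eq) (vertexAt-∈W P k)))
  vertexAt-injective (step _ _ P) (u∉P , _)  {fsuc i} {fzero}  eq =
    ⊥-elim (u∉P (subst (_∈W P) eq (vertexAt-∈W P i)))
  vertexAt-injective (step _ _ P) (_ , path) {fsuc i} {fsuc k} eq =
    cong fsuc (vertexAt-injective P path eq)

  prod-edgeAt : ∀ {u v} (P : W u v) → prod (length P) (λ i → w (edgeAt P i)) ≡ weight P
  prod-edgeAt []           = refl
  prod-edgeAt (step e _ P) = cong (w e ·_) (prod-edgeAt P)

  closedPath⇒circle : ∀ {u x e} (j : Joins′ e u x) (Q : W x u) → IsPath Q → 2 ≤ length Q →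
    Σ (Circle G) λ C → prod (len C) (λ i → w (edge C i)) ≡ weight (step e j Q)
  closedPath⇒circle {u} j Q path 2≤len = record
    { len      = suc (length Q)
    ; len≥3    = s≤s 2≤len
    ; vtx      = vertexAt Cw
    ; closed   = vertexAt-last Q
    ; distinct = vertices-distinct
    ; edge     = edgeAt Cw
    ; joins    = edgeAt-joins Cw
    } , prod-edgeAt Cw
    where
      Cw = step _ j Q

      u≢inner : ∀ k → u ≢ vertexAt Q (inject₁ k)
      u≢inner k eq = fromℕ≢inject₁ {i = k} (vertexAt-injective Q path (trans (vertexAt-last Q) eq))

      vertices-distinct : Injective _≡_ _≡_ (λ (i : Fin (suc (length Q))) → vertexAt Cw (inject₁ i))
      vertices-distinct {fzero}  {fzero}  _  = refl
      vertices-distinct {fzero}  {fsuc k} eq = ⊥-elim (u≢inner k eq)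
      vertices-distinct {fsuc i} {fzero}  eq = ⊥-elim (u≢inner i (sym eq))
      vertices-distinct {fsuc i} {fsuc k} eq = cong fsuc (inject₁-injective (vertexAt-injective Q path eq))

  noLoop : ∀ {e a} → ¬ Joins′ e a a
  noLoop {e} (inj₁ eq) = noLoops G e (trans (cong proj₁ eq) (sym (cong proj₂ eq)))
  noLoop {e} (inj₂ eq) = noLoops G e (trans (cong proj₁ eq) (sym (cong proj₂ eq)))

  noParallel : ∀ {e f a b} → Joins′ e a b → Joins′ f b a → e ≡ f
  noParallel {e} {f} (inj₁ eq) jf =
    noMulti G e f (subst (λ p → Joins′ f (proj₁ p) (proj₂ p)) (sym eq) (joins-sym jf))
  noParallel {e} {f} (inj₂ eq) jf =
    noMulti G e f (subst (λ p → Joins′ f (proj₁ p) (proj₂ p)) (sym eq) jf)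

  module _ (positive : AllCirclesPositive G w) where

    closedPath-positive : ∀ {u x e} (j : Joins′ e u x) (Q : W x u) → IsPath Q →
      w e · weight Q ≡ plus
    closedPath-positive j []                        _    = ⊥-elim (noLoop j)
    closedPath-positive j (step f j′ [])            _
      rewrite noParallel j j′ = trans (cong (w f ·_) (·-identityʳ (w f))) (·-inverse (w f))
    closedPath-positive j Q@(step _ _ (step _ _ _)) path =
      let C , prod≡weight = closedPath⇒circle j Q path (s≤s (s≤s z≤n))
      in trans (sym prod≡weight) (positive C)

    -- Cutting out the closed subwalk at the first repeated vertex does not change the weight.
    shortcut : ∀ {u v} (P : W u v) → Σ (W u v) λ P′ → IsPath P′ × weight P′ ≡ weight P
    shortcut [] = [] , tt , refl
    shortcut {u} (step e j P) with shortcut P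
    ... | P′ , path , weight≡ with u ∈W? P′
    ...   | no  u∉P′ = step e j P′ , (u∉P′ , path) , cong (w e ·_) weight≡
    ...   | yes u∈P′ = suffix , suffix-isPath , sym (begin
              w e · weight P                          ≡⟨ cong (w e ·_) (sym weight≡) ⟩
              w e · weight P′                         ≡⟨ cong (w e ·_) weight-split ⟩
              w e · (weight prefix · weight suffix)   ≡⟨ sym (·-assoc (w e) _ _) ⟩
              (w e · weight prefix) · weight suffix   ≡⟨ cong (_· weight suffix)
                                                           (closedPath-positive j prefix prefix-isPath) ⟩
              weight suffix                           ∎)
      where
        open Split (split u P′ u∈P′ path)
        open ≡-Reasoning

    closedWalk-positive : ∀ {u} (P : W u u) → weight P ≡ plus
    closedWalk-positive P with shortcut P
    ... | []           , _           , weight≡ = sym weight≡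
    ... | step _ _ P′  , (u∉P′ , _) , _       = ⊥-elim (u∉P′ (end∈W P′))

    weight-across-edge : ∀ {z x y e} (P : W z x) (Q : W z y) → Joins′ e x y →
      weight P ≡ w e · weight Q
    weight-across-edge {e = e} P Q j = ·≡plus⇒≡ (begin
      weight P · (w e · weight Q)                   ≡⟨ cong (λ s → weight P · (w e · s))
                                                         (sym (weight-reverse Q)) ⟩
      weight P · weight (step e j (reverse Q))      ≡⟨ sym (weight-++ P _) ⟩
      weight (P ++ step e j (reverse Q))            ≡⟨ closedWalk-positive (P ++ step e j (reverse Q)) ⟩
      plus                                          ∎)
      where open ≡-Reasoning

isMinus : Sign → Bool
isMinus plus  = false
isMinus minus = true

isMinus-injective : ∀ {a b} → isMinus a ≡ isMinus b → a ≡ b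
isMinus-injective {plus}  {plus}  _ = refl
isMinus-injective {minus} {minus} _ = refl

origin : ∀ {k} → Fin k → Fin k
origin {suc k} _ = fzero

origin-constant : ∀ {k} (a b : Fin k) → origin a ≡ origin b
origin-constant {suc k} _ _ = refl

-- Colour each vertex by the weight of a walk to it from a fixed base vertex.
allCirclesPositive⇒negativeEdgesBipartite : ∀ G w → AllCirclesPositive G w →
  Σ (Fin (n G) → Bool) λ c → ∀ e → w e ≡ minus → c (proj₁ (ends G e)) ≢ c (proj₂ (ends G e))
allCirclesPositive⇒negativeEdgesBipartite G w positive = colour , proper
  where
    open WalkSigns G w

    colourFrom : V → V → Bool
    colourFrom z v = isMinus (weight (connected G z v))

    properFrom : ∀ z e → w e ≡ minus →
      colourFrom z (proj₁ (ends G e)) ≢ colourFrom z (proj₂ (ends G e))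
    properFrom z e we≡minus same = negate-≢ (weight Q) (begin
      minus · weight Q    ≡⟨ cong (_· weight Q) (sym we≡minus) ⟩
      w e · weight Q      ≡⟨ sym (weight-across-edge positive P Q (inj₁ refl)) ⟩
      weight P            ≡⟨ isMinus-injective same ⟩
      weight Q            ∎)
      where
        open ≡-Reasoning
        P = connected G z (proj₁ (ends G e))
        Q = connected G z (proj₂ (ends G e))

    colour : V → Bool
    colour v = colourFrom (origin v) v

    proper : ∀ e → w e ≡ minus → colour (proj₁ (ends G e)) ≢ colour (proj₂ (ends G e))
    proper e = subst (λ z → w e ≡ minus → colour x ≢ colourFrom z (proj₂ (ends G e)))
                     (origin-constant x (proj₂ (ends G e))) (properFrom (origin x) e)
      where x = proj₁ (ends G e)

cutOf : (G : Graph) → (Fin (n G) → Bool) → Fin (m G) → Bool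
cutOf G c e = c (proj₁ (ends G e)) xor c (proj₂ (ends G e))

xor-≢ : ∀ {a b} → a ≢ b → a xor b ≡ true
xor-≢ {true}  {true}  a≢b = ⊥-elim (a≢b refl)
xor-≢ {true}  {false} _   = refl
xor-≢ {false} {true}  _   = refl
xor-≢ {false} {false} a≢b = ⊥-elim (a≢b refl)

bipartite⇒disjointNegationSet : ∀ S A → NegationSet S A → BipartiteEdgeSet (graph S) A →
  Σ (Subset (m (graph S))) (λ B → NegationSet S B × Disjoint A B)
bipartite⇒disjointNegationSet S A negA (c , proper) = B , negB , disjoint
  where
    open ≡-Reasoning
    G = graph S

    B : Subset (m G)
    B = tabulate (λ e → lookup A e xor cutOf G c e)

    difference≡switching : ∀ e → differenceSign A B e ≡ switchingSign G (λ v → sign (c v)) e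
    difference≡switching e = begin
      negationSign A e · sign (lookup B e)
        ≡⟨ cong (λ b → negationSign A e · sign b) (lookup∘tabulate _ e) ⟩
      negationSign A e · sign (lookup A e xor cutOf G c e)
        ≡⟨ cong (negationSign A e ·_) (sign-xor (lookup A e) (cutOf G c e)) ⟩
      negationSign A e · (negationSign A e · sign (cutOf G c e))
        ≡⟨ ·-cancelˡ (negationSign A e) _ ⟩
      sign (cutOf G c e)
        ≡⟨ sign-xor (c (proj₁ (ends G e))) (c (proj₂ (ends G e))) ⟩
      switchingSign G (λ v → sign (c v)) e   ∎

    negB : NegationSet S B
    negB C = begin
      circleSign (negateSet S B) C
        ≡⟨ cong (_· circleSign (negateSet S B) C) (sym (negA C)) ⟩
      circleSign (negateSet S A) C · circleSign (negateSet S B) C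
        ≡⟨ circleSign-negateSet-· S A B C ⟩
      prod (len C) (λ i → differenceSign A B (edge C i))
        ≡⟨ prod-cong (len C) (λ i → difference≡switching (edge C i)) ⟩
      prod (len C) (λ i → switchingSign G (λ v → sign (c v)) (edge C i))
        ≡⟨ switching-allCirclesPositive G (λ v → sign (c v)) C ⟩
      plus   ∎

    disjoint : Disjoint A B
    disjoint e e∈A e∈B with () ← begin
      true                            ≡⟨ sym ([]=⇒lookup e∈B) ⟩
      lookup B e                      ≡⟨ lookup∘tabulate _ e ⟩
      lookup A e xor cutOf G c e      ≡⟨ cong₂ _xor_ ([]=⇒lookup e∈A) (xor-≢ (proper e e∈A)) ⟩
      false                           ∎

disjointNegationSet⇒bipartite : ∀ S A → NegationSet S A →
  Σ (Subset (m (graph S))) (λ B → NegationSet S B × Disjoint A B) → BipartiteEdgeSet (graph S) A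
disjointNegationSet⇒bipartite S A negA (B , negB , disjoint) =
  let c , proper = allCirclesPositive⇒negativeEdgesBipartite (graph S) (differenceSign A B)
                     (negationSets⇒differencePositive S A B negA negB)
  in c , λ e e∈A → proper e (differenceSign-minus e e∈A)
  where
    differenceSign-minus : ∀ e → e ∈ A → differenceSign A B e ≡ minus
    differenceSign-minus e e∈A with lookup B e in eq
    ... | true  = ⊥-elim (disjoint e e∈A (lookup⇒[]= e B eq))
    ... | false rewrite []=⇒lookup e∈A = refl

theorem3p1 : (S : SignedGraph) (A : Subset (m (graph S))) → NegationSet S A →
    ((BipartiteEdgeSet (graph S) A → Σ (Subset (m (graph S))) (λ B → NegationSet S B × Disjoint A B))
    × (Σ (Subset (m (graph S))) (λ B → NegationSet S B × Disjoint A B) → BipartiteEdgeSet (graph S) A))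
theorem3p1 S A negA =
  bipartite⇒disjointNegationSet S A negA , disjointNegationSet⇒bipartite S A negA
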